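{- Let $X=(V,E)$ be a digraph, and let $e_1,e_2,e_3\in E$ form a directed triangle (a directed $3$-cycle) in $X$. Writing $X\setminus S=(V,E\setminus S)$, we have $$U_X=U_{X\setminus\{e_1\}}+U_{X\setminus\{e_2\}}+U_{X\setminus\{e_3\}}-U_{X\setminus\{e_1,e_2\}}-U_{X\setminus\{e_2,e_3\}}-U_{X\setminus\{e_3,e_1\}}+U_{X\setminus\{e_1,e_2,e_3\}}.$$
   Context: A digraph $X=(V,E)$ has a finite vertex set $V$, $|V|=n$, and $E\subseteq V\times V$. The edges form a directed triangle if $e_1=(a,b)$, $e_2=(b,c)$, $e_3=(c,a)$ with $a,b,c$ distinct. A $V$-listing is a bijection $\pi:[n]\to V$, and $X\mathrm{Des}(\pi)=\{i\in[n-1]:(\pi_i,\pi_{i+1})\in E\}$. Let $F_I=\sum_{i_1\le\dots\le i_n,\ i_j<i_{j+1}\ (j\in I)}x_{i_1}\cdots x_{i_n}$ for $I\subseteq[n-1]$. The Redei-Berge function is $U_X=\sum_\pi F_{X\mathrm{Des}(\pi)}$ over all $V$-listings. -}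

module Defs where

open import Data.Bool using (Bool; true; false; _∧_; not; if_then_else_)
open import Data.Nat using (ℕ; zero; suc; _<ᵇ_; _≤ᵇ_)
open import Data.Fin using (Fin)
open import Data.Fin.Properties using (_≟_)
open import Data.List using (List; []; _∷_; map; concatMap)
open import Data.Nat.ListAction using (sum)
open import Data.Bool.ListAction using (any)
open import Data.List.Base using (allFin)
open import Data.Vec using (Vec; toList) renaming ([] to []ᵥ; _∷_ to _∷ᵥ_)
open import Data.Product using (_×_; _,_)
open import Relation.Nullary.Decidable using (⌊_⌋)

Digraph : ℕ → Set
Digraph n = Fin n → Fin n → Bool

_==_ : {n : ℕ} → Fin n → Fin n → Bool
x == y = ⌊ x ≟ y ⌋

removeEdges : {n : ℕ} → Digraph n → List (Fin n × Fin n) → Digraph n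
removeEdges E S u v = E u v ∧ not (any (λ { (a , b) → (a == u) ∧ (b == v) }) S)

allVecs : (n k : ℕ) → List (Vec (Fin n) k)
allVecs n zero = []ᵥ ∷ []
allVecs n (suc k) = concatMap (λ v → map (λ x → x ∷ᵥ v) (allFin n)) (allVecs n k)

distinct : {n : ℕ} → List (Fin n) → Bool
distinct [] = true
distinct (x ∷ xs) = not (any (x ==_) xs) ∧ distinct xs

-- V-listings: bijections [n] → V, represented as the sequence (π_1 , … , π_n)
-- of pairwise distinct vertices (an injection Fin n → Fin n is a bijection).
listings : (n : ℕ) → List (Vec (Fin n) n)
listings n = keep (allVecs n n)
  where
  keep : List (Vec (Fin n) n) → List (Vec (Fin n) n)
  keep [] = []
  keep (v ∷ vs) = if distinct (toList v) then v ∷ keep vs else keep vs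

-- Coefficient of F_I (I = XDes(π)) at the monomial x_{s_1} ⋯ x_{s_n}:
-- true iff s_1 ≤ ⋯ ≤ s_n and s_j < s_{j+1} whenever (π_j , π_{j+1}) ∈ E.
fOK : {n : ℕ} → Digraph n → List (Fin n) → List ℕ → Bool
fOK E (u ∷ v ∷ us) (a ∷ b ∷ as) =
  (if E u v then a <ᵇ b else a ≤ᵇ b) ∧ fOK E (v ∷ us) (b ∷ as)
fOK E _ _ = true

-- Redei–Berge function U_X, given by its coefficients: the coefficient of the
-- monomial x_{s_1} ⋯ x_{s_n} (s weakly increasing) is
-- Σ_π [coefficient of that monomial in F_{XDes(π)}].
redeiBerge : {n : ℕ} → Digraph n → Vec ℕ n → ℕ
redeiBerge {n} E s =
  sum (map (λ π → if fOK E (toList π) (toList s) then 1 else 0) (listings n))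

-- For a fixed listing π, the coefficient of a monomial in F_{XDes(π)} depends
-- on the edge set only through the consecutive pairs (π_i , π_{i+1}).  A
-- listing has no repeated vertex, so it cannot traverse all three edges of a
-- directed triangle; if e is an edge it misses, S ↦ S △ {e} pairs off the
-- subsets S of {e₁, e₂, e₃} into terms of opposite sign and equal value, and
-- the signed sum vanishes.  Summing over listings gives the identity.
module Submission where

open import Defs
open import Data.Nat using (ℕ)
open import Data.Integer using (ℤ; +_; _+_; _-_)
open import Data.Fin using (Fin)
open import Data.Bool using (true)
open import Data.Vec using (Vec)
open import Data.List using ([]; _∷_)
open import Data.Product using (_,_)
open import Relation.Binary.PropositionalEquality using (_≡_; _≢_)

open import Data.Bool using (Bool; false; _∧_; _∨_; not; if_then_else_)
open import Data.Bool.ListAction using (any)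
open import Data.Bool.Properties using (∧-identityʳ; ∨-isCommutativeMonoid)
open import Data.Empty using (⊥; ⊥-elim)
open import Data.Fin.Properties using (_≟_)
open import Data.Integer.Properties using (pos-+)
import Data.Integer.Tactic.RingSolver as ℤ-Solver
open import Data.List using (List; map)
open import Data.List.Membership.Propositional using (_∈_)
open import Data.List.Properties using (map-cong)
open import Data.List.Relation.Binary.Permutation.Propositional using (_↭_; ↭⇒↭ₛ; ↭-refl; ↭-trans; prep; swap)
open import Data.List.Relation.Binary.Permutation.Propositional.Properties using (map⁺)
open import Data.List.Relation.Binary.Permutation.Setoid.Properties using (foldr-commMonoid)
open import Data.List.Relation.Unary.All as All using (All; []; _∷_)
open import Data.List.Relation.Unary.AllPairs using ([]; _∷_)
open import Data.List.Relation.Unary.Any using (here; there)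
open import Data.List.Relation.Unary.Unique.Propositional using (Unique)
import Data.Nat as ℕ
open import Data.Nat.ListAction using (sum)
import Data.Nat.Tactic.RingSolver as ℕ-Solver
open import Data.Product using (_×_)
open import Data.Vec using (toList)
open import Function using (_∘_; _$_)
open import Relation.Binary.Core using (_Preserves_⟶_)
open import Relation.Binary.Definitions using (DecidableEquality)
open import Relation.Binary.PropositionalEquality using (refl; sym; trans; cong; cong₂; setoid; module ≡-Reasoning)
open import Relation.Nullary using (Dec; yes; no; ¬_)

data Adjacent {A : Set} (u v : A) : List A → Set where
  here  : ∀ {xs} → Adjacent u v (u ∷ v ∷ xs)
  there : ∀ {x xs} → Adjacent u v xs → Adjacent u v (x ∷ xs)

module _ {A : Set} where

  private variable
    a b c u v x : A
    xs : List A

  adjacent? : DecidableEquality A → (u v : A) (xs : List A) → Dec (Adjacent u v xs)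
  adjacent? _≟_ u v []           = no λ ()
  adjacent? _≟_ u v (x ∷ [])     = no λ { (there ()) }
  adjacent? _≟_ u v (x ∷ y ∷ xs) with x ≟ u | y ≟ v | adjacent? _≟_ u v (y ∷ xs)
  ... | yes refl | yes refl | _        = yes here
  ... | _        | _        | yes adj  = yes (there adj)
  ... | no x≢u   | _        | no ¬adj  = no λ { here → x≢u refl ; (there adj) → ¬adj adj }
  ... | yes _    | no y≢v   | no ¬adj  = no λ { here → y≢v refl ; (there adj) → ¬adj adj }

  Adjacent⇒target∈tail : Adjacent u v (x ∷ xs) → v ∈ xs
  Adjacent⇒target∈tail here                      = here refl
  Adjacent⇒target∈tail {xs = _ ∷ _} (there adj) = there (Adjacent⇒target∈tail adj)

  Unique⇒head-has-no-predecessor : Unique (x ∷ xs) → ¬ Adjacent u x (x ∷ xs)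
  Unique⇒head-has-no-predecessor (x∉xs ∷ _) adj = All.lookup x∉xs (Adjacent⇒target∈tail adj) refl

  Unique⇒¬3-cycle : Unique xs → Adjacent a b xs → Adjacent b c xs → Adjacent c a xs → ⊥
  Unique⇒¬3-cycle uniq here bc   ca   = Unique⇒head-has-no-predecessor uniq ca
  Unique⇒¬3-cycle uniq ab   here ca   = Unique⇒head-has-no-predecessor uniq ab
  Unique⇒¬3-cycle uniq ab   bc   here = Unique⇒head-has-no-predecessor uniq bc
  Unique⇒¬3-cycle (_ ∷ uniq) (there ab) (there bc) (there ca) = Unique⇒¬3-cycle uniq ab bc ca

module _ {X : Set} where

  private variable
    e f g : X
    w w′ : List X → ℕ

  evenSum oddSum : (List X → ℕ) → X → X → X → ℕ
  evenSum w e f g = w [] ℕ.+ w (e ∷ f ∷ []) ℕ.+ w (f ∷ g ∷ []) ℕ.+ w (g ∷ e ∷ [])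
  oddSum  w e f g = w (e ∷ []) ℕ.+ w (f ∷ []) ℕ.+ w (g ∷ []) ℕ.+ w (e ∷ f ∷ g ∷ [])

  record InclusionExclusion (w : List X → ℕ) (e f g : X) : Set where
    constructor inclusionExclusion
    field evenSum≡oddSum : evenSum w e f g ≡ oddSum w e f g

  inclusionExclusion-deletable : w Preserves _↭_ ⟶ _≡_ → (∀ S → w (e ∷ S) ≡ w S) →
                                 InclusionExclusion w e f g
  inclusionExclusion-deletable {w} {e} {f} {g} w-↭ delete-e = inclusionExclusion $ begin
    w [] ℕ.+ w (e ∷ f ∷ []) ℕ.+ w (f ∷ g ∷ []) ℕ.+ w (g ∷ e ∷ [])
      ≡⟨ cong₂ (λ wf wg → w [] ℕ.+ wf ℕ.+ w (f ∷ g ∷ []) ℕ.+ wg)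
               (delete-e _) (trans (w-↭ (swap g e ↭-refl)) (delete-e _)) ⟩
    w [] ℕ.+ w (f ∷ []) ℕ.+ w (f ∷ g ∷ []) ℕ.+ w (g ∷ [])
      ≡⟨ swap-last-two (w []) _ _ _ ⟩
    w [] ℕ.+ w (f ∷ []) ℕ.+ w (g ∷ []) ℕ.+ w (f ∷ g ∷ [])
      ≡⟨ cong₂ (λ we wefg → we ℕ.+ w (f ∷ []) ℕ.+ w (g ∷ []) ℕ.+ wefg)
               (delete-e []) (delete-e (f ∷ g ∷ [])) ⟨
    w (e ∷ []) ℕ.+ w (f ∷ []) ℕ.+ w (g ∷ []) ℕ.+ w (e ∷ f ∷ g ∷ []) ∎
    where
    open ≡-Reasoning
    swap-last-two : ∀ a b c d → a ℕ.+ b ℕ.+ c ℕ.+ d ≡ a ℕ.+ b ℕ.+ d ℕ.+ c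
    swap-last-two = ℕ-Solver.solve-∀

  inclusionExclusion-rotate : w Preserves _↭_ ⟶ _≡_ →
                              InclusionExclusion w e f g → InclusionExclusion w f g e
  inclusionExclusion-rotate {w} {e} {f} {g} w-↭ (inclusionExclusion ie) = inclusionExclusion $ begin
    w [] ℕ.+ w (f ∷ g ∷ []) ℕ.+ w (g ∷ e ∷ []) ℕ.+ w (e ∷ f ∷ [])
      ≡⟨ rotate-last-three (w []) _ _ _ ⟩
    evenSum w e f g
      ≡⟨ ie ⟩
    w (e ∷ []) ℕ.+ w (f ∷ []) ℕ.+ w (g ∷ []) ℕ.+ w (e ∷ f ∷ g ∷ [])
      ≡⟨ cong₂ ℕ._+_ (rotate-first-three (w (e ∷ [])) _ _)
               (w-↭ (↭-trans (swap e f ↭-refl) (prep f (swap e g ↭-refl)))) ⟩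
    w (f ∷ []) ℕ.+ w (g ∷ []) ℕ.+ w (e ∷ []) ℕ.+ w (f ∷ g ∷ e ∷ []) ∎
    where
    open ≡-Reasoning
    rotate-last-three : ∀ a b c d → a ℕ.+ b ℕ.+ c ℕ.+ d ≡ a ℕ.+ d ℕ.+ b ℕ.+ c
    rotate-last-three = ℕ-Solver.solve-∀
    rotate-first-three : ∀ a b c → a ℕ.+ b ℕ.+ c ≡ b ℕ.+ c ℕ.+ a
    rotate-first-three = ℕ-Solver.solve-∀

  inclusionExclusion-+ : InclusionExclusion w e f g → InclusionExclusion w′ e f g →
                         InclusionExclusion (λ S → w S ℕ.+ w′ S) e f g
  inclusionExclusion-+ {w} {e} {f} {g} {w′} (inclusionExclusion ie) (inclusionExclusion ie′) =
    inclusionExclusion $ begin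
    evenSum (λ S → w S ℕ.+ w′ S) e f g    ≡⟨ interchange (w []) (w′ []) _ _ _ _ _ _ ⟩
    evenSum w e f g ℕ.+ evenSum w′ e f g  ≡⟨ cong₂ ℕ._+_ ie ie′ ⟩
    oddSum w e f g ℕ.+ oddSum w′ e f g    ≡⟨ interchange (w (e ∷ [])) (w′ (e ∷ [])) _ _ _ _ _ _ ⟨
    oddSum (λ S → w S ℕ.+ w′ S) e f g     ∎
    where
    open ≡-Reasoning
    interchange : ∀ a a′ b b′ c c′ d d′ →
      (a ℕ.+ a′) ℕ.+ (b ℕ.+ b′) ℕ.+ (c ℕ.+ c′) ℕ.+ (d ℕ.+ d′) ≡
      (a ℕ.+ b ℕ.+ c ℕ.+ d) ℕ.+ (a′ ℕ.+ b′ ℕ.+ c′ ℕ.+ d′)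
    interchange = ℕ-Solver.solve-∀

  inclusionExclusion-sum : {Y : Set} (v : Y → List X → ℕ) (ys : List Y) →
                           All (λ y → InclusionExclusion (v y) e f g) ys →
                           InclusionExclusion (λ S → sum (map (λ y → v y S) ys)) e f g
  inclusionExclusion-sum v []       []          = inclusionExclusion refl
  inclusionExclusion-sum v (y ∷ ys) (ie ∷ ies) =
    inclusionExclusion-+ ie (inclusionExclusion-sum v ys ies)

  inclusionExclusion⇒signed : InclusionExclusion w e f g →
    + w [] ≡ + w (e ∷ []) + + w (f ∷ []) + + w (g ∷ [])
             - + w (e ∷ f ∷ []) - + w (f ∷ g ∷ []) - + w (g ∷ e ∷ [])
             + + w (e ∷ f ∷ g ∷ [])
  inclusionExclusion⇒signed {w} {e} {f} {g} (inclusionExclusion ie) = begin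
    + a                                            ≡⟨ add-and-subtract (+ a) (+ c₁) (+ c₂) (+ c₃) ⟩
    + a + + c₁ + + c₂ + + c₃ - + c₁ - + c₂ - + c₃  ≡⟨ cong (λ t → t - + c₁ - + c₂ - + c₃) ie-in-ℤ ⟩
    + b₁ + + b₂ + + b₃ + + d - + c₁ - + c₂ - + c₃  ≡⟨ move-last (+ b₁) (+ b₂) (+ b₃) (+ d) (+ c₁) (+ c₂) (+ c₃) ⟩
    + b₁ + + b₂ + + b₃ - + c₁ - + c₂ - + c₃ + + d  ∎
    where
    open ≡-Reasoning
    a b₁ b₂ b₃ c₁ c₂ c₃ d : ℕ
    a = w []
    b₁ = w (e ∷ [])
    b₂ = w (f ∷ [])
    b₃ = w (g ∷ [])
    c₁ = w (e ∷ f ∷ [])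
    c₂ = w (f ∷ g ∷ [])
    c₃ = w (g ∷ e ∷ [])
    d = w (e ∷ f ∷ g ∷ [])
    pos-+₄ : ∀ x y z t → + (x ℕ.+ y ℕ.+ z ℕ.+ t) ≡ + x + + y + + z + + t
    pos-+₄ x y z t = trans (pos-+ (x ℕ.+ y ℕ.+ z) t)
                       (cong (_+ + t) (trans (pos-+ (x ℕ.+ y) z) (cong (_+ + z) (pos-+ x y))))
    ie-in-ℤ : + a + + c₁ + + c₂ + + c₃ ≡ + b₁ + + b₂ + + b₃ + + d
    ie-in-ℤ = trans (sym (pos-+₄ a c₁ c₂ c₃)) (trans (cong +_ ie) (pos-+₄ b₁ b₂ b₃ d))
    add-and-subtract : ∀ x y z t → x ≡ x + y + z + t - y - z - t
    add-and-subtract = ℤ-Solver.solve-∀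
    move-last : ∀ x₁ x₂ x₃ x₄ y₁ y₂ y₃ → x₁ + x₂ + x₃ + x₄ - y₁ - y₂ - y₃ ≡ x₁ + x₂ + x₃ - y₁ - y₂ - y₃ + x₄
    move-last = ℤ-Solver.solve-∀

any-==-false⇒All≢ : ∀ {n} {x : Fin n} xs → any (x ==_) xs ≡ false → All (x ≢_) xs
any-==-false⇒All≢ []               _ = []
any-==-false⇒All≢ {x = x} (y ∷ ys) h with x ≟ y
... | no x≢y = x≢y ∷ any-==-false⇒All≢ ys h

distinct⇒Unique : ∀ {n} (xs : List (Fin n)) → distinct xs ≡ true → Unique xs
distinct⇒Unique []       _ = []
distinct⇒Unique (x ∷ xs) h with any (x ==_) xs in x∈xs
... | false = any-==-false⇒All≢ xs x∈xs ∷ distinct⇒Unique xs h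

-- The filter in `listings` is local to its `where` block; it is pinned down by
-- its two defining equations, which hold by refl once `allVecs n n` is abstracted.
filter-sound : {A : Set} (P : A → Bool) (keep : List A → List A) →
               keep [] ≡ [] →
               (∀ x xs → keep (x ∷ xs) ≡ (if P x then x ∷ keep xs else keep xs)) →
               ∀ xs → All (λ x → P x ≡ true) (keep xs)
filter-sound P keep keep-[] keep-∷ [] rewrite keep-[] = []
filter-sound P keep keep-[] keep-∷ (x ∷ xs) rewrite keep-∷ x xs with P x in Px
... | true  = Px ∷ filter-sound P keep keep-[] keep-∷ xs
... | false = filter-sound P keep keep-[] keep-∷ xs

listings-distinct : ∀ n → All (λ π → distinct (toList π) ≡ true) (listings n)
listings-distinct n with allVecs n n | filter-sound (distinct ∘ toList) _ refl (λ _ _ → refl)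
... | vecs | keep-sound = keep-sound vecs

listings-Unique : ∀ n → All (Unique ∘ toList) (listings n)
listings-Unique n = All.map (distinct⇒Unique _) (listings-distinct n)

module _ {n : ℕ} where

  private variable
    G H : Digraph n
    p q u v : Fin n
    S S′ : List (Fin n × Fin n)

  ≢⇒pair-==-false : (p , q) ≢ (u , v) → (u == p) ∧ (v == q) ≡ false
  ≢⇒pair-==-false {p} {q} {u} {v} pq≢uv with u ≟ p | v ≟ q
  ... | yes refl | yes refl = ⊥-elim (pq≢uv refl)
  ... | yes _    | no _     = refl
  ... | no _     | _        = refl

  removeEdges-[] : ∀ G → removeEdges G [] p q ≡ G p q
  removeEdges-[] G = ∧-identityʳ _

  removeEdges-↭ : ∀ G → S ↭ S′ → removeEdges G S p q ≡ removeEdges G S′ p q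
  removeEdges-↭ G S↭S′ =
    cong (λ removed → _ ∧ not removed)
         (foldr-commMonoid (setoid Bool) ∨-isCommutativeMonoid (↭⇒↭ₛ (map⁺ _ S↭S′)))

  removeEdges-∷-≢ : ∀ G u v S → (p , q) ≢ (u , v) →
                    removeEdges G ((u , v) ∷ S) p q ≡ removeEdges G S p q
  removeEdges-∷-≢ {p} {q} G u v S pq≢uv =
    cong (λ uv-matches → G p q ∧ not (uv-matches ∨ any (λ { (a , b) → (a == p) ∧ (b == q) }) S))
         (≢⇒pair-==-false pq≢uv)

  fOK-cong : ∀ xs → (∀ {p q} → Adjacent p q xs → G p q ≡ H p q) → ∀ ss → fOK G xs ss ≡ fOK H xs ss
  fOK-cong []           _     _             = refl
  fOK-cong (_ ∷ [])     _     _             = refl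
  fOK-cong (_ ∷ _ ∷ _)  _     []            = refl
  fOK-cong (_ ∷ _ ∷ _)  _     (_ ∷ [])      = refl
  fOK-cong (_ ∷ y ∷ ys) G≡H (s ∷ t ∷ ss) =
    cong₂ _∧_ (cong (λ edge → if edge then s ℕ.<ᵇ t else s ℕ.≤ᵇ t) (G≡H here))
              (fOK-cong (y ∷ ys) (G≡H ∘ there) (t ∷ ss))

  coefficient : Digraph n → List (Fin n) → List ℕ → ℕ
  coefficient G xs ss = if fOK G xs ss then 1 else 0

  coefficient-cong : ∀ xs → (∀ {p q} → Adjacent p q xs → G p q ≡ H p q) →
                     ∀ ss → coefficient G xs ss ≡ coefficient H xs ss
  coefficient-cong xs G≡H ss = cong (λ ok → if ok then 1 else 0) (fOK-cong xs G≡H ss)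

  redeiBerge-removeEdges-[] : ∀ (G : Digraph n) s → redeiBerge (removeEdges G []) s ≡ redeiBerge G s
  redeiBerge-removeEdges-[] G s =
    cong sum (map-cong (λ π → coefficient-cong (toList π) (λ _ → removeEdges-[] G) (toList s)) (listings n))

  module _ (E : Digraph n) (xs : List (Fin n)) (ss : List ℕ) where

    private
      w : List (Fin n × Fin n) → ℕ
      w S = coefficient (removeEdges E S) xs ss

      w-↭ : w Preserves _↭_ ⟶ _≡_
      w-↭ S↭S′ = coefficient-cong xs (λ _ → removeEdges-↭ E S↭S′) ss

      untraversed-deletable : ¬ Adjacent u v xs → ∀ S → w ((u , v) ∷ S) ≡ w S
      untraversed-deletable {u} {v} ¬uv S =
        coefficient-cong xs (λ pq → removeEdges-∷-≢ E u v S λ { refl → ¬uv pq }) ss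

    triangle-inclusionExclusion : ∀ a b c → Unique xs → InclusionExclusion w (a , b) (b , c) (c , a)
    triangle-inclusionExclusion a b c xs-unique
      with adjacent? _≟_ a b xs | adjacent? _≟_ b c xs | adjacent? _≟_ c a xs
    ... | no ¬ab | _      | _      = inclusionExclusion-deletable w-↭ (untraversed-deletable ¬ab)
    ... | yes _  | no ¬bc | _      = inclusionExclusion-rotate w-↭ (inclusionExclusion-rotate w-↭
                                       (inclusionExclusion-deletable w-↭ (untraversed-deletable ¬bc)))
    ... | yes _  | yes _  | no ¬ca = inclusionExclusion-rotate w-↭
                                       (inclusionExclusion-deletable w-↭ (untraversed-deletable ¬ca))
    ... | yes ab | yes bc | yes ca = ⊥-elim (Unique⇒¬3-cycle xs-unique ab bc ca)

mainTheorem7 : (n : ℕ) (E : Digraph n) (a b c : Fin n) →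
    a ≢ b → b ≢ c → c ≢ a →
    E a b ≡ true → E b c ≡ true → E c a ≡ true →
    (s : Vec ℕ n) →
    + redeiBerge E s ≡
    + redeiBerge (removeEdges E ((a , b) ∷ [])) s
    + + redeiBerge (removeEdges E ((b , c) ∷ [])) s
    + + redeiBerge (removeEdges E ((c , a) ∷ [])) s
    - + redeiBerge (removeEdges E ((a , b) ∷ (b , c) ∷ [])) s
    - + redeiBerge (removeEdges E ((b , c) ∷ (c , a) ∷ [])) s
    - + redeiBerge (removeEdges E ((c , a) ∷ (a , b) ∷ [])) s
    + + redeiBerge (removeEdges E ((a , b) ∷ (b , c) ∷ (c , a) ∷ [])) s
mainTheorem7 n E a b c _ _ _ _ _ _ s =
  trans (cong +_ (sym (redeiBerge-removeEdges-[] E s)))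
        (inclusionExclusion⇒signed
          (inclusionExclusion-sum coefficientOf (listings n)
            (All.map (λ {π} → triangle-inclusionExclusion E (toList π) (toList s) a b c)
                     (listings-Unique n))))
  where
  coefficientOf : Vec (Fin n) n → List (Fin n × Fin n) → ℕ
  coefficientOf π S = coefficient (removeEdges E S) (toList π) (toList s)
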